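{- Let $N\ge 3$ be odd and let $A_1,A_2,\ldots$ be a quasifibonacci sequence of level $N$. Let $k\ge N$ be an integer. Then for every integer $n$ with $A_k\le n<A_{k+1}$, $|h_n|\le 2^{k-N}$.
   Context: For an integer $N\ge 2$, a sequence $A_1,A_2,\ldots$ of positive integers is a quasifibonacci sequence of level $N$ if $A_{k+N}=A_{k+N-1}+\cdots+A_k$ for all $k\ge 1$, and $A_k>A_{k-1}+\cdots+A_1$ for all $1\le k\le N$. Let $h_n$ denote the coefficient of $x^n$ in the formal power series $\prod_{k\ge1}(1-x^{A_k})$; equivalently $h_n$ is the number of partitions of $n$ into an even number of distinct terms $A_k$ minus the number of partitions of $n$ into an odd number of distinct terms $A_k$. -}

module Defs where

open import Data.Nat using (ℕ; zero; suc; _+_; _∸_; _≤_; _<_; _≤?_)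
open import Data.Integer using (ℤ; +_; _-_)
open import Relation.Nullary using (yes; no)
open import Relation.Binary.PropositionalEquality using (_≡_)

-- Sequences are functions ℕ → ℕ, indexed from 1 as in the paper (A 0 is ignored).

sumFrom : (ℕ → ℕ) → ℕ → ℕ → ℕ
sumFrom A a zero = 0
sumFrom A a (suc len) = A a + sumFrom A (suc a) len

record IsQuasifibonacci (N : ℕ) (A : ℕ → ℕ) : Set where
  field
    positive   : ∀ k → 1 ≤ k → 1 ≤ A k
    recurrence : ∀ k → 1 ≤ k → A (k + N) ≡ sumFrom A k N
    initial    : ∀ k → 1 ≤ k → k ≤ N → sumFrom A 1 (k ∸ 1) < A k

-- δ n = 1 if n = 0, else 0  (coefficient of x^n in the constant series 1)
δ : ℕ → ℤ
δ zero = + 1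
δ (suc _) = + 0

-- partialCoeff A M n = coefficient of x^n in the polynomial ∏_{k=1}^{M} (1 - x^{A k}).
-- Uses ∏_{k≤M+1} = (∏_{k≤M}) · (1 - x^{A(M+1)}).
partialCoeff : (ℕ → ℕ) → ℕ → ℕ → ℤ
partialCoeff A zero n = δ n
partialCoeff A (suc M) n with A (suc M) ≤? n
... | yes _ = partialCoeff A M n - partialCoeff A M (n ∸ A (suc M))
... | no  _ = partialCoeff A M n

-- Write c_M(n) for the coefficient of x^n in P_M = ∏_{k ≤ M} (1 - x^{A_k}),
-- so that c_{M+1}(n) = c_M(n) - c_M(n - A_{M+1}) (the second term only when
-- A_{M+1} ≤ n).  The proof has three independent ingredients:
--   * the first N terms are superincreasing, so P_N has coefficients in
--     {-1, 0, 1}: P_M has degree A_1 + ... + A_M < A_{M+1}, hence the two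
--     terms of the recursion never overlap;
--   * by the triangle inequality each further factor at most doubles the
--     largest coefficient, so |c_{d+N}(n)| ≤ 2^d;
--   * from index N on the sequence is nondecreasing (A_{i+1} is a sum of N
--     terms ending with A_i), so for A_k ≤ n < A_{k+1} every factor with index
--     beyond k leaves the coefficient of x^n unchanged: c_M(n) = c_k(n).
-- Combining them with d = k - N gives the bound 2^{k-N}.
module Submission where

open import Defs
open import Data.Nat using (ℕ; _+_; _∸_; _≤_; _<_; _^_)
open import Data.Nat.Divisibility using (_∣_)
open import Data.Integer using (∣_∣)
open import Relation.Nullary using (¬_)

open import Data.Nat using (zero; suc; _*_; z≤n; s≤s; _≤?_)
open import Data.Nat.Properties
open import Data.Integer using (_-_)
import Data.Integer as ℤ
import Data.Integer.Properties as ℤP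
open import Data.Product using (_,_)
open import Relation.Nullary using (yes; no)
open import Relation.Binary.PropositionalEquality
open import Data.Empty using (⊥-elim)

coeff : (ℕ → ℕ) → ℕ → ℕ → ℤ.ℤ
coeff = partialCoeff

prefixSum : (ℕ → ℕ) → ℕ → ℕ
prefixSum A = sumFrom A 1

sumFrom-snoc : ∀ A a l → sumFrom A a (suc l) ≡ sumFrom A a l + A (l + a)
sumFrom-snoc A a zero = +-identityʳ (A a)
sumFrom-snoc A a (suc l) = begin
    A a + sumFrom A (suc a) (suc l)
  ≡⟨ cong (A a +_) (sumFrom-snoc A (suc a) l) ⟩
    A a + (sumFrom A (suc a) l + A (l + suc a))
  ≡⟨ cong (λ i → A a + (sumFrom A (suc a) l + A i)) (+-suc l a) ⟩
    A a + (sumFrom A (suc a) l + A (suc l + a))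
  ≡⟨ sym (+-assoc (A a) _ _) ⟩
    A a + sumFrom A (suc a) l + A (suc l + a)
  ∎
  where open ≡-Reasoning

prefixSum-suc : ∀ A m → prefixSum A (suc m) ≡ prefixSum A m + A (suc m)
prefixSum-suc A m =
  trans (sumFrom-snoc A 1 m) (cong (λ i → prefixSum A m + A i) (+-comm m 1))

last≤sumFrom : ∀ A a l → A (l + a) ≤ sumFrom A a (suc l)
last≤sumFrom A a l =
  subst (A (l + a) ≤_) (sym (sumFrom-snoc A a l)) (m≤n+m (A (l + a)) _)

coeff-degree : ∀ A M n → prefixSum A M < n → coeff A M n ≡ ℤ.+ 0
coeff-degree A zero (suc n) _ = refl
coeff-degree A (suc M) n deg<n with A (suc M) ≤? n
... | yes a≤n = cong₂ _-_ (coeff-degree A M n below)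
                          (coeff-degree A M (n ∸ A (suc M)) shifted)
  where
  sum<n : prefixSum A M + A (suc M) < n
  sum<n = subst (_< n) (prefixSum-suc A M) deg<n
  below : prefixSum A M < n
  below = ≤-<-trans (m≤m+n (prefixSum A M) _) sum<n
  shifted : prefixSum A M < n ∸ A (suc M)
  shifted = m+n≤o⇒m≤o∸n (suc (prefixSum A M)) sum<n
... | no _ = coeff-degree A M n
               (≤-<-trans (subst (prefixSum A M ≤_) (sym (prefixSum-suc A M))
                                 (m≤m+n (prefixSum A M) _)) deg<n)

Superincreasing : (ℕ → ℕ) → ℕ → Set
Superincreasing A M = ∀ j → j < M → prefixSum A j < A (suc j)

-- If A_1, ..., A_M are superincreasing, then P_M has all coefficients in {-1, 0, 1}: when A_{M+1} ≤ n we are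
-- above the degree of P_M, so c_{M+1}(n) = -c_M(n - A_{M+1}).
coeff-superincreasing : ∀ A M → Superincreasing A M →
                        ∀ n → ∣ coeff A M n ∣ ≤ 1
coeff-superincreasing A zero _ zero = ≤-refl
coeff-superincreasing A zero _ (suc n) = z≤n
coeff-superincreasing A (suc M) super n with A (suc M) ≤? n
... | yes a≤n = begin
    ∣ coeff A M n - coeff A M (n ∸ A (suc M)) ∣
  ≡⟨ cong (λ c → ∣ c - coeff A M (n ∸ A (suc M)) ∣)
          (coeff-degree A M n (<-≤-trans (super M ≤-refl) a≤n)) ⟩
    ∣ ℤ.+ 0 - coeff A M (n ∸ A (suc M)) ∣
  ≤⟨ ℤP.∣i-j∣≤∣i∣+∣j∣ (ℤ.+ 0) (coeff A M (n ∸ A (suc M))) ⟩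
    ∣ coeff A M (n ∸ A (suc M)) ∣
  ≤⟨ coeff-superincreasing A M super′ (n ∸ A (suc M)) ⟩
    1
  ∎
  where
  open ≤-Reasoning
  super′ : Superincreasing A M
  super′ j j<M = super j (m≤n⇒m≤1+n j<M)
... | no _ = coeff-superincreasing A M (λ j j<M → super j (m≤n⇒m≤1+n j<M)) n

coeff-suc-bound : ∀ A M n →
  ∣ coeff A (suc M) n ∣ ≤ ∣ coeff A M n ∣ + ∣ coeff A M (n ∸ A (suc M)) ∣
coeff-suc-bound A M n with A (suc M) ≤? n
... | yes _ = ℤP.∣i-j∣≤∣i∣+∣j∣ (coeff A M n) (coeff A M (n ∸ A (suc M)))
... | no _ = m≤m+n ∣ coeff A M n ∣ _

coeff-doubling : ∀ A M b → (∀ n → ∣ coeff A M n ∣ ≤ b) →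
                 ∀ d n → ∣ coeff A (d + M) n ∣ ≤ 2 ^ d * b
coeff-doubling A M b base zero n = subst (_ ≤_) (sym (+-identityʳ b)) (base n)
coeff-doubling A M b base (suc d) n = begin
    ∣ coeff A (suc (d + M)) n ∣
  ≤⟨ coeff-suc-bound A (d + M) n ⟩
    ∣ coeff A (d + M) n ∣ + ∣ coeff A (d + M) (n ∸ A (suc (d + M))) ∣
  ≤⟨ +-mono-≤ (coeff-doubling A M b base d n)
              (coeff-doubling A M b base d (n ∸ A (suc (d + M)))) ⟩
    2 ^ d * b + 2 ^ d * b
  ≡⟨ cong (2 ^ d * b +_) (sym (+-identityʳ (2 ^ d * b))) ⟩
    2 * (2 ^ d * b)
  ≡⟨ sym (*-assoc 2 (2 ^ d) b) ⟩
    2 ^ suc d * b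
  ∎
  where open ≤-Reasoning

coeff-stable : ∀ A k n → (∀ j → k < j → n < A j) →
               ∀ d → coeff A (d + k) n ≡ coeff A k n
coeff-stable A k n large zero = refl
coeff-stable A k n large (suc d) with A (suc (d + k)) ≤? n
... | yes a≤n = ⊥-elim (<⇒≱ (large (suc (d + k)) (s≤s (m≤n+m k d))) a≤n)
... | no _ = coeff-stable A k n large d

module Quasifibonacci (N : ℕ) (A : ℕ → ℕ) (q : IsQuasifibonacci N A) where
  open IsQuasifibonacci q

  superincreasing : Superincreasing A N
  superincreasing j j<N = initial (suc j) (s≤s z≤n) j<N

  coeff-bound : ∀ d n → ∣ coeff A (d + N) n ∣ ≤ 2 ^ d
  coeff-bound d n = subst (∣ coeff A (d + N) n ∣ ≤_) (*-identityʳ (2 ^ d))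
    (coeff-doubling A N 1 (coeff-superincreasing A N superincreasing) d n)

  -- From index N on the sequence is nondecreasing: for i = o + N with N ≥ 1,
  -- A_{i+1} = A_{o+1} + ... + A_i, whose last term is A_i.
  step : 1 ≤ N → ∀ i → N ≤ i → A i ≤ A (suc i)
  step (s≤s {n = N′} _) i N≤i with m≤n⇒∃[o]m+o≡n N≤i
  ... | o , refl = begin
      A (N + o)
    ≡⟨ cong A (sym (+-suc N′ o)) ⟩
      A (N′ + suc o)
    ≤⟨ last≤sumFrom A (suc o) N′ ⟩
      sumFrom A (suc o) N
    ≡⟨ sym (recurrence (suc o) (s≤s z≤n)) ⟩
      A (suc o + N)
    ≡⟨ cong A (cong suc (+-comm o N)) ⟩
      A (suc (N + o))
    ∎
    where open ≤-Reasoning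

  monotone : 1 ≤ N → ∀ i → N ≤ i → ∀ d → A i ≤ A (d + i)
  monotone 1≤N i N≤i zero = ≤-refl
  monotone 1≤N i N≤i (suc d) =
    ≤-trans (monotone 1≤N i N≤i d) (step 1≤N (d + i) (≤-trans N≤i (m≤n+m i d)))

  tail-large : 1 ≤ N → ∀ k → N ≤ k → ∀ n → n < A (suc k) → ∀ j → k < j → n < A j
  tail-large 1≤N k N≤k n n<A j k<j = begin-strict
      n
    <⟨ n<A ⟩
      A (suc k)
    ≤⟨ monotone 1≤N (suc k) (m≤n⇒m≤1+n N≤k) (j ∸ suc k) ⟩
      A (j ∸ suc k + suc k)
    ≡⟨ cong A (m∸n+n≡m k<j) ⟩
      A j
    ∎
    where open ≤-Reasoning

-- Main theorem: for A_k ≤ n < A_{k+1} and M past all terms ≤ n,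
-- the coefficient c_M(n) = h_n satisfies |h_n| ≤ 2^{k-N}.
proposition5p4 : (N : ℕ) → 3 ≤ N → ¬ (2 ∣ N) →
    (A : ℕ → ℕ) → IsQuasifibonacci N A →
    (k : ℕ) → N ≤ k → (n : ℕ) → A k ≤ n → n < A (k + 1) →
    (M : ℕ) → (∀ j → M < j → n < A j) →
    ∣ partialCoeff A M n ∣ ≤ 2 ^ (k ∸ N)
proposition5p4 N 3≤N _ A q k N≤k n Ak≤n n<A M large with k ≤? M
... | no k≰M = ⊥-elim (<⇒≱ (large k (≰⇒> k≰M)) Ak≤n)
... | yes k≤M = begin
    ∣ coeff A M n ∣
  ≡⟨ cong (λ m → ∣ coeff A m n ∣) (sym (m∸n+n≡m k≤M)) ⟩
    ∣ coeff A (M ∸ k + k) n ∣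
  ≡⟨ cong ∣_∣ (coeff-stable A k n tail (M ∸ k)) ⟩
    ∣ coeff A k n ∣
  ≡⟨ cong (λ m → ∣ coeff A m n ∣) (sym (m∸n+n≡m N≤k)) ⟩
    ∣ coeff A (k ∸ N + N) n ∣
  ≤⟨ coeff-bound (k ∸ N) n ⟩
    2 ^ (k ∸ N)
  ∎
  where
  open ≤-Reasoning
  open Quasifibonacci N A q
  1≤N : 1 ≤ N
  1≤N = ≤-trans (s≤s z≤n) 3≤N
  tail : ∀ j → k < j → n < A j
  tail = tail-large 1≤N k N≤k n (subst (λ i → n < A i) (+-comm k 1) n<A)
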